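{- Let $p$ be a positive integer and let $\mathcal{I}=(\emptyset,I_1,\dots,I_K)$ be a fixed sequence of intervention targets with $I_k\subseteq[p]$. Then $\mathrm{CIM}_p^{\mathcal{I}}$ is a face of $\mathrm{CIM}_{p,K}$.
   Context: For a sequence $\mathcal{J}=(\emptyset,J_1,\dots,J_K)$ of subsets of $[p]$ and a DAG $\mathcal{G}$ on $[p]$, the $\mathcal{J}$-DAG $\mathcal{G}^{\mathcal{J}}$ is the DAG on $[p]\cup\{z_1,\dots,z_K\}$ with the edges of $\mathcal{G}$ together with $z_k\to i$ for all $i\in J_k$. For a DAG $\mathcal{D}$ on a finite set $V$ and $A\subseteq V$, $c_{\mathcal{D}}(A)=1$ if some $a\in A$ has every $b\in A\setminus\{a\}$ as a parent in $\mathcal{D}$, and $0$ otherwise (the characteristic imset). $\mathrm{CIM}_{p,K}=\mathrm{conv}\{c_{\mathcal{G}^{\mathcal{J}}}\}$ over all DAGs $\mathcal{G}$ on $[p]$ and all such sequences $\mathcal{J}$; $\mathrm{CIM}_p^{\mathcal{I}}=\mathrm{conv}\{c_{\mathcal{G}^{\mathcal{I}}}:\mathcal{G}\text{ a DAG on }[p]\}$. -}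

module Defs where

open import Data.Nat as ℕ using (ℕ; zero; suc)
open import Data.Fin using (Fin; splitAt; _≟_)
open import Data.Fin.Subset using (Subset)
open import Data.Vec using (Vec; []; _∷_; lookup)
open import Data.Bool using (Bool; true; false; _∧_; _∨_; not; if_then_else_)
open import Data.List.Base using (allFin)
open import Data.Bool.ListAction using (any; all)
open import Data.Rational using (ℚ; 0ℚ; 1ℚ; _+_; _*_; _≤_)
open import Data.Sum using (inj₁; inj₂)
open import Data.Product using (Σ; ∃; ∃-syntax; _×_)
open import Relation.Binary.PropositionalEquality using (_≡_)
open import Relation.Nullary using (¬_)
open import Relation.Nullary.Decidable using (⌊_⌋)
open import Function.Bundles using (_⇔_)

-- Directed graphs on the vertex set Fin n (= [n]).
-- E b a ≡ true  means there is an edge  b → a  (b is a parent of a).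

Digraph : ℕ → Set
Digraph n = Fin n → Fin n → Bool

data Walk⁺ {n : ℕ} (E : Digraph n) : Fin n → Fin n → Set where
  edge : ∀ {i j} → E i j ≡ true → Walk⁺ E i j
  step : ∀ {i j k} → E i j ≡ true → Walk⁺ E j k → Walk⁺ E i k

IsAcyclic : {n : ℕ} → Digraph n → Set
IsAcyclic {n} E = (i : Fin n) → ¬ Walk⁺ E i i

record DAG (n : ℕ) : Set where
  field
    edges   : Digraph n
    acyclic : IsAcyclic edges

-- The J-DAG  G^J  on  [p] ∪ {z_1,…,z_K}, encoded as Fin (p + K):
-- vertex i ∈ [p] is  i ↑ˡ K,  vertex z_k is  p ↑ʳ k.
-- J : Fin K → Subset p  encodes the targets (J_1,…,J_K) (J_0 = ∅ implicit).

JDAG : (p K : ℕ) → DAG p → (Fin K → Subset p) → Digraph (p ℕ.+ K)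
JDAG p K G J u v with splitAt p u | splitAt p v
... | inj₁ i | inj₁ j = DAG.edges G i j
... | inj₂ k | inj₁ j = lookup (J k) j
... | _      | _      = false

charImset : {n : ℕ} → Digraph n → Subset n → Bool
charImset {n} E A =
  any (λ a → lookup A a ∧
             all (λ b → not (lookup A b) ∨ ⌊ b ≟ a ⌋ ∨ E b a) (allFin n))
      (allFin n)

toℚ : Bool → ℚ
toℚ b = if b then 1ℚ else 0ℚ

Point : ℕ → Set
Point n = Subset n → ℚ

sumFin : (m : ℕ) → (Fin m → ℚ) → ℚ
sumFin zero    f = 0ℚ
sumFin (suc m) f = f Fin.zero + sumFin m (λ i → f (Fin.suc i))

sumSub : (n : ℕ) → (Subset n → ℚ) → ℚ
sumSub zero    f = f []
sumSub (suc n) f = sumSub n (λ A → f (true ∷ A)) + sumSub n (λ A → f (false ∷ A))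

dot : {n : ℕ} → Point n → Point n → ℚ
dot {n} w x = sumSub n (λ A → w A * x A)

InConv : {n : ℕ} → (Point n → Set) → Point n → Set
InConv {n} S x =
  ∃[ m ] Σ (Fin m → ℚ) λ λs → Σ (Fin m → Point n) λ v →
    ((i : Fin m) → 0ℚ ≤ λs i) ×
    (sumFin m λs ≡ 1ℚ) ×
    ((i : Fin m) → S (v i)) ×
    ((A : Subset n) → x A ≡ sumFin m (λ i → λs i * v i A))

IsFace : {n : ℕ} → (Point n → Set) → (Point n → Set) → Set
IsFace {n} F P =
  Σ (Point n) λ w → Σ ℚ λ b →
    ((x : Point n) → P x → dot w x ≤ b) ×
    ((x : Point n) → F x ⇔ (P x × dot w x ≡ b))

imsetOf : {n : ℕ} → Digraph n → Point n
imsetOf E A = toℚ (charImset E A)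

CIM : (p K : ℕ) → Point (p ℕ.+ K) → Set
CIM p K = InConv (λ y → Σ (DAG p) λ G → Σ (Fin K → Subset p) λ J →
                          (A : Subset (p ℕ.+ K)) → y A ≡ imsetOf (JDAG p K G J) A)

CIMI : (p K : ℕ) → (Fin K → Subset p) → Point (p ℕ.+ K) → Set
CIMI p K I = InConv (λ y → Σ (DAG p) λ G →
                          (A : Subset (p ℕ.+ K)) → y A ≡ imsetOf (JDAG p K G I) A)

{-# OPTIONS --safe #-}
-- Let w put weight +1 or -1 on each two-element set {i, z_k}, with sign + exactly when i ∈ I_k,
-- and 0 on all other sets.  Since z_k is a source whose children are exactly J_k, the imset
-- of G^J takes the value [i ∈ J_k] on {i, z_k}; so w · c_{G^J} = Σ_{k,i} ±[i ∈ J_k] does not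
-- depend on G and is maximal exactly when J = I.  Hence w · x ≤ w · c_{G^I} is valid on
-- CIM_{p,K} and its tight vertices are exactly the vertices of CIM_p^I, and a valid inequality
-- cuts out of a convex hull the convex hull of its tight vertices.
module Submission where

open import Defs
open import Data.Nat using (ℕ; _≤_)
open import Data.Fin using (Fin)
open import Data.Fin.Subset using (Subset)

open import Data.Nat as ℕ using (zero; suc)
open import Data.Fin as Fin using (_↑ˡ_; _↑ʳ_; splitAt)
open import Data.Fin.Properties using (splitAt-↑ˡ; splitAt-↑ʳ)
open import Data.Fin.Subset using (_∈_; ⁅_⁆; _∪_)
open import Data.Fin.Subset.Properties using (x∈⁅x⁆; x∈⁅y⁆⇒x≡y; x∈p∪q⁻; x∈p∪q⁺)
open import Data.Vec using ([]; _∷_; lookup)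
open import Data.Vec.Properties using ([]=⇒lookup; lookup⇒[]=) renaming (≡-dec to ≡-dec-Vec)
open import Data.Bool using (Bool; true; false; T; not; _∧_; _∨_)
open import Data.Bool.ListAction using (and; or)
open import Data.Bool.Properties using (T-≡; T-∧; T-∨; ∨-identityʳ) renaming (_≟_ to _≟ᵇ_)
open import Data.List using (allFin)
open import Data.List.Properties using (map-cong)
open import Data.List.Membership.Propositional using (lose)
open import Data.List.Membership.Propositional.Properties using (∈-allFin)
open import Data.List.Relation.Unary.All as All using ()
open import Data.List.Relation.Unary.All.Properties using (all⁺; all⁻)
open import Data.List.Relation.Unary.Any using (satisfied)
open import Data.List.Relation.Unary.Any.Properties using (any⁺; any⁻)
open import Data.Rational using (ℚ; 0ℚ; 1ℚ; _+_; _*_; -_; 1/_; NonZero; nonNegative; ≢-nonZero)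
  renaming (_≤_ to _≤ℚ_)
open import Data.Rational.Properties
  using (≤-refl; ≤-trans; ≤-reflexive; ≤-antisym; <⇒≤; <⇒≢; <-cmp; _≤?_; module ≤-Reasoning;
         +-mono-≤; +-mono-<-≤; +-comm; +-identityˡ; +-identityʳ; +-0-commutativeMonoid;
         *-comm; *-assoc; *-identityˡ; *-zeroˡ; *-inverseˡ; *-distribˡ-+; *-distribʳ-+; *-monoˡ-≤-nonNeg)
  renaming (_≟_ to _≟ℚ_)
open import Algebra.Bundles using (CommutativeMonoid)
open import Algebra.Properties.CommutativeSemigroup
  (CommutativeMonoid.commutativeSemigroup +-0-commutativeMonoid) using () renaming (interchange to +-interchange)
open import Data.Empty using (⊥-elim)
open import Data.Sum as Sum using (_⊎_; inj₁; inj₂)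
open import Data.Product using (∃; _×_; _,_; proj₁; proj₂)
open import Function using (_∘_; id; _⇔_; mk⇔; Equivalence)
open import Relation.Binary using (tri<; tri≈; tri>)
open import Relation.Binary.PropositionalEquality
  using (_≡_; _≢_; refl; sym; trans; cong; cong₂; module ≡-Reasoning)
open import Relation.Nullary using (does; yes; no; contradiction)
open import Relation.Nullary.Decidable using (⌊_⌋; toWitness; fromWitness)

open Equivalence using (to; from)

+-mono-≤-tightˡ : ∀ {a b c d} → a ≤ℚ c → b ≤ℚ d → a + b ≡ c + d → a ≡ c
+-mono-≤-tightˡ {a} {c = c} a≤c b≤d eq with <-cmp a c
... | tri< a<c _ _ = contradiction eq (<⇒≢ (+-mono-<-≤ a<c b≤d))
... | tri≈ _ a≡c _ = a≡c
... | tri> _ _ c<a = ≤-antisym a≤c (<⇒≤ c<a)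

+-mono-≤-tightʳ : ∀ {a b c d} → a ≤ℚ c → b ≤ℚ d → a + b ≡ c + d → b ≡ d
+-mono-≤-tightʳ {a} {b} {c} {d} a≤c b≤d eq =
  +-mono-≤-tightˡ b≤d a≤c (trans (+-comm b a) (trans eq (+-comm c d)))

*-cancelˡ-≡ : ∀ r .{{_ : NonZero r}} {x y} → r * x ≡ r * y → x ≡ y
*-cancelˡ-≡ r {x} {y} eq = trans (sym (inverse-cancel x)) (trans (cong (1/ r *_) eq) (inverse-cancel y))
  where
  inverse-cancel : ∀ z → 1/ r * (r * z) ≡ z
  inverse-cancel z = trans (sym (*-assoc (1/ r) r z)) (trans (cong (_* z) (*-inverseˡ r)) (*-identityˡ z))

sumFin-cong : ∀ m {f g : Fin m → ℚ} → (∀ j → f j ≡ g j) → sumFin m f ≡ sumFin m g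
sumFin-cong zero    f≗g = refl
sumFin-cong (suc m) f≗g = cong₂ _+_ (f≗g Fin.zero) (sumFin-cong m (f≗g ∘ Fin.suc))

sumFin-mono-≤ : ∀ m {f g : Fin m → ℚ} → (∀ j → f j ≤ℚ g j) → sumFin m f ≤ℚ sumFin m g
sumFin-mono-≤ zero    f≤g = ≤-refl
sumFin-mono-≤ (suc m) f≤g = +-mono-≤ (f≤g Fin.zero) (sumFin-mono-≤ m (f≤g ∘ Fin.suc))

sumFin-mono-≤-tight : ∀ m {f g : Fin m → ℚ} → (∀ j → f j ≤ℚ g j) →
                      sumFin m f ≡ sumFin m g → ∀ j → f j ≡ g j
sumFin-mono-≤-tight (suc m) f≤g eq Fin.zero    =
  +-mono-≤-tightˡ (f≤g Fin.zero) (sumFin-mono-≤ m (f≤g ∘ Fin.suc)) eq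
sumFin-mono-≤-tight (suc m) f≤g eq (Fin.suc j) =
  sumFin-mono-≤-tight m (f≤g ∘ Fin.suc)
    (+-mono-≤-tightʳ (f≤g Fin.zero) (sumFin-mono-≤ m (f≤g ∘ Fin.suc)) eq) j

sumFin-+ : ∀ m (f g : Fin m → ℚ) → sumFin m (λ j → f j + g j) ≡ sumFin m f + sumFin m g
sumFin-+ zero    f g = sym (+-identityʳ 0ℚ)
sumFin-+ (suc m) f g = trans (cong (f Fin.zero + g Fin.zero +_) (sumFin-+ m (f ∘ Fin.suc) (g ∘ Fin.suc)))
  (+-interchange (f Fin.zero) (g Fin.zero) _ _)

*-distribʳ-sumFin : ∀ m c (f : Fin m → ℚ) → sumFin m f * c ≡ sumFin m (λ j → f j * c)
*-distribʳ-sumFin zero    c f = *-zeroˡ c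
*-distribʳ-sumFin (suc m) c f =
  trans (*-distribʳ-+ c (f Fin.zero) _) (cong (f Fin.zero * c +_) (*-distribʳ-sumFin m c (f ∘ Fin.suc)))

sumSub-cong : ∀ n {f g : Subset n → ℚ} → (∀ A → f A ≡ g A) → sumSub n f ≡ sumSub n g
sumSub-cong zero    f≗g = f≗g []
sumSub-cong (suc n) f≗g = cong₂ _+_ (sumSub-cong n (f≗g ∘ (true ∷_))) (sumSub-cong n (f≗g ∘ (false ∷_)))

*-distribˡ-sumSub : ∀ n c (f : Subset n → ℚ) → c * sumSub n f ≡ sumSub n (λ A → c * f A)
*-distribˡ-sumSub zero    c f = refl
*-distribˡ-sumSub (suc n) c f = trans (*-distribˡ-+ c _ _)
  (cong₂ _+_ (*-distribˡ-sumSub n c (f ∘ (true ∷_))) (*-distribˡ-sumSub n c (f ∘ (false ∷_))))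

sumSub-sumFin : ∀ n m (f : Fin m → Subset n → ℚ) →
                sumSub n (λ A → sumFin m (λ j → f j A)) ≡ sumFin m (λ j → sumSub n (f j))
sumSub-sumFin zero    m f = refl
sumSub-sumFin (suc n) m f = trans
  (cong₂ _+_ (sumSub-sumFin n m (λ j A → f j (true ∷ A))) (sumSub-sumFin n m (λ j A → f j (false ∷ A))))
  (sym (sumFin-+ m _ _))

sumSub-zeroˡ : ∀ n (f : Subset n → ℚ) → sumSub n (λ A → 0ℚ * f A) ≡ 0ℚ
sumSub-zeroˡ n f = trans (sym (*-distribˡ-sumSub n 0ℚ f)) (*-zeroˡ (sumSub n f))

dot-comm : ∀ {n} (w x : Point n) → dot w x ≡ dot x w
dot-comm {n} w x = sumSub-cong n (λ A → *-comm (w A) (x A))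

dot-congʳ : ∀ {n} (w : Point n) {x y : Point n} → (∀ A → x A ≡ y A) → dot w x ≡ dot w y
dot-congʳ {n} w x≗y = sumSub-cong n (λ A → cong (w A *_) (x≗y A))

dot-sumFinˡ : ∀ {n} m (u : Fin m → Point n) (x : Point n) →
              dot (λ A → sumFin m (λ j → u j A)) x ≡ sumFin m (λ j → dot (u j) x)
dot-sumFinˡ {n} m u x = trans
  (sumSub-cong n (λ A → *-distribʳ-sumFin m (x A) (λ j → u j A)))
  (sumSub-sumFin n m (λ j A → u j A * x A))

dot-*ˡ : ∀ {n} c (u x : Point n) → dot (λ A → c * u A) x ≡ c * dot u x
dot-*ˡ {n} c u x = trans (sumSub-cong n (λ A → *-assoc c (u A) (x A))) (sym (*-distribˡ-sumSub n c _))

-- `does` rather than ⌊_⌋: only the former computes on cons cells, as dot-basisˡ needs.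
basis : ∀ {n} → Subset n → Point n
basis B A = toℚ (does (≡-dec-Vec _≟ᵇ_ A B))

dot-basisˡ : ∀ {n} (B : Subset n) (x : Point n) → dot (basis B) x ≡ x B
dot-basisˡ []               x = *-identityˡ (x [])
dot-basisˡ {suc n} (true ∷ B)  x = trans
  (cong₂ _+_ (dot-basisˡ B (x ∘ (true ∷_))) (sumSub-zeroˡ n (x ∘ (false ∷_))))
  (+-identityʳ (x (true ∷ B)))
dot-basisˡ {suc n} (false ∷ B) x = trans
  (cong₂ _+_ (sumSub-zeroˡ n (x ∘ (true ∷_))) (dot-basisˡ B (x ∘ (false ∷_))))
  (+-identityˡ (x (false ∷ B)))

convex-combination-const : ∀ m (λs : Fin m → ℚ) → sumFin m λs ≡ 1ℚ →
                           ∀ c → sumFin m (λ j → λs j * c) ≡ c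
convex-combination-const m λs Σλs≡1 c =
  trans (sym (*-distribʳ-sumFin m c λs)) (trans (cong (_* c) Σλs≡1) (*-identityˡ c))

dot-convex : ∀ {n m} (w : Point n) (λs : Fin m → ℚ) (v : Fin m → Point n) {x : Point n} →
             (∀ A → x A ≡ sumFin m (λ j → λs j * v j A)) →
             dot w x ≡ sumFin m (λ j → λs j * dot w (v j))
dot-convex {m = m} w λs v {x} x≡ = begin
  dot w x                                      ≡⟨ dot-congʳ w x≡ ⟩
  dot w (λ A → sumFin m (λ j → λs j * v j A))  ≡⟨ dot-comm w _ ⟩
  dot (λ A → sumFin m (λ j → λs j * v j A)) w  ≡⟨ dot-sumFinˡ m (λ j A → λs j * v j A) w ⟩
  sumFin m (λ j → dot (λ A → λs j * v j A) w)  ≡⟨ sumFin-cong m (λ j → dot-*ˡ (λs j) (v j) w) ⟩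
  sumFin m (λ j → λs j * dot (v j) w)          ≡⟨ sumFin-cong m (λ j → cong (λs j *_) (dot-comm (v j) w)) ⟩
  sumFin m (λ j → λs j * dot w (v j))          ∎
  where open ≡-Reasoning

module _ {n : ℕ} {S T : Point n → Set} (w : Point n) (b : ℚ) (valid : ∀ y → S y → dot w y ≤ℚ b) where

  weighted-valid : ∀ {m} (λs : Fin m → ℚ) (v : Fin m → Point n) →
                   (∀ j → 0ℚ ≤ℚ λs j) → (∀ j → S (v j)) → ∀ j → λs j * dot w (v j) ≤ℚ λs j * b
  weighted-valid λs v λs≥0 v∈S j = *-monoˡ-≤-nonNeg (λs j) {{nonNegative (λs≥0 j)}} (valid (v j) (v∈S j))

  InConv-valid : ∀ x → InConv S x → dot w x ≤ℚ b
  InConv-valid x (m , λs , v , λs≥0 , Σλs≡1 , v∈S , x≡) = begin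
    dot w x
      ≡⟨ dot-convex w λs v x≡ ⟩
    sumFin m (λ j → λs j * dot w (v j))
      ≤⟨ sumFin-mono-≤ m (weighted-valid λs v λs≥0 v∈S) ⟩
    sumFin m (λ j → λs j * b)
      ≡⟨ convex-combination-const m λs Σλs≡1 b ⟩
    b ∎
    where open ≤-Reasoning

  InConv-face : (∀ y → T y ⇔ (S y × dot w y ≡ b)) → ∃ T → IsFace (InConv T) (InConv S)
  InConv-face tight t₀ = w , b , InConv-valid , λ x → mk⇔ (hull⊆face x) (face⊆hull x)
    where
    hull⊆face : ∀ x → InConv T x → InConv S x × dot w x ≡ b
    hull⊆face _ (m , λs , v , λs≥0 , Σλs≡1 , v∈T , x≡) =
      (m , λs , v , λs≥0 , Σλs≡1 , proj₁ ∘ vertex-tight , x≡) ,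
      trans (dot-convex w λs v x≡)
        (trans (sumFin-cong m (λ j → cong (λs j *_) (proj₂ (vertex-tight j))))
               (convex-combination-const m λs Σλs≡1 b))
      where
      vertex-tight : ∀ j → S (v j) × dot w (v j) ≡ b
      vertex-tight j = to (tight (v j)) (v∈T j)

    face⊆hull : ∀ x → InConv S x × dot w x ≡ b → InConv T x
    face⊆hull _ ((m , λs , v , λs≥0 , Σλs≡1 , v∈S , x≡) , wx≡b) =
      m , λs , proj₁ ∘ v′ , λs≥0 , Σλs≡1 , proj₁ ∘ proj₂ ∘ v′ ,
      λ A → trans (x≡ A) (sumFin-cong m (λ j → proj₂ (proj₂ (v′ j)) A))
      where
      weighted-tight : ∀ j → λs j * dot w (v j) ≡ λs j * b
      weighted-tight = sumFin-mono-≤-tight m (weighted-valid λs v λs≥0 v∈S)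
        (trans (sym (dot-convex w λs v x≡)) (trans wx≡b (sym (convex-combination-const m λs Σλs≡1 b))))

      zero-weight : ∀ {c} → c ≡ 0ℚ → ∀ y z → c * y ≡ c * z
      zero-weight refl y z = trans (*-zeroˡ y) (sym (*-zeroˡ z))

      -- A vertex of weight 0 need not be tight; it is swapped for the point t₀ of T.
      v′ : ∀ j → ∃ λ y → T y × (∀ A → λs j * v j A ≡ λs j * y A)
      v′ j with λs j ≟ℚ 0ℚ
      ... | yes λ≡0 = proj₁ t₀ , proj₂ t₀ , λ A → zero-weight λ≡0 (v j A) (proj₁ t₀ A)
      ... | no  λ≢0 =
        v j , from (tight (v j)) (v∈S j , *-cancelˡ-≡ (λs j) {{≢-nonZero λ≢0}} (weighted-tight j)) ,
        λ A → refl

T-⇔⇒≡ : ∀ {x y} → T x ⇔ T y → x ≡ y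
T-⇔⇒≡ {false} {false} _ = refl
T-⇔⇒≡ {false} {true}  h = ⊥-elim (from h _)
T-⇔⇒≡ {true}  {false} h = ⊥-elim (to h _)
T-⇔⇒≡ {true}  {true}  _ = refl

T-not-∨ : ∀ {x y} → T (not x ∨ y) ⇔ (T x → T y)
T-not-∨ {false} = mk⇔ (λ _ ()) (λ _ → _)
T-not-∨ {true}  = mk⇔ (λ t _ → t) (λ f → f _)

T-lookup⇔∈ : ∀ {n} {A : Subset n} {x : Fin n} → T (lookup A x) ⇔ x ∈ A
T-lookup⇔∈ {A = A} {x} = mk⇔ (lookup⇒[]= x A ∘ to T-≡) (from T-≡ ∘ []=⇒lookup)

module _ {n : ℕ} (E : Digraph n) where

  IsSinkOf : Subset n → Fin n → Set
  IsSinkOf A a = a ∈ A × (∀ {b} → b ∈ A → b ≡ a ⊎ T (E b a))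

  charImset-true⇔ : ∀ A → T (charImset E A) ⇔ ∃ (IsSinkOf A)
  charImset-true⇔ A = mk⇔ charImset⇒sink sink⇒charImset
    where
    parentCondition⇔ : ∀ a b → T (not (lookup A b) ∨ ⌊ b Fin.≟ a ⌋ ∨ E b a) ⇔
                               (b ∈ A → b ≡ a ⊎ T (E b a))
    parentCondition⇔ a b = mk⇔
      (λ t b∈A → Sum.map₁ toWitness (to T-∨ (to T-not-∨ t (from T-lookup⇔∈ b∈A))))
      (λ f → from T-not-∨ (λ t → from T-∨ (Sum.map₁ fromWitness (f (to T-lookup⇔∈ t)))))

    charImset⇒sink : T (charImset E A) → ∃ (IsSinkOf A)
    charImset⇒sink t with satisfied (any⁻ _ (allFin n) t)
    ... | a , a-sink with to T-∧ a-sink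
    ... | a∈A , parents =
      a , to T-lookup⇔∈ a∈A ,
      λ {b} → to (parentCondition⇔ a b) (All.lookup (all⁺ _ (allFin n) parents) (∈-allFin b))

    sink⇒charImset : ∃ (IsSinkOf A) → T (charImset E A)
    sink⇒charImset (a , a∈A , parents) =
      any⁺ _ (lose (∈-allFin a) (from T-∧ (from T-lookup⇔∈ a∈A ,
        all⁻ _ {allFin n} (All.tabulate (λ {b} _ → from (parentCondition⇔ a b) parents)))))

  charImset-pair : ∀ {u v} → u ≢ v → charImset E (⁅ u ⁆ ∪ ⁅ v ⁆) ≡ E v u ∨ E u v
  charImset-pair {u} {v} u≢v =
    T-⇔⇒≡ (mk⇔ (sink⇒edge ∘ to (charImset-true⇔ _)) (from (charImset-true⇔ _) ∘ edge⇒sink))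
    where
    member : ∀ {x} → x ∈ ⁅ u ⁆ ∪ ⁅ v ⁆ → x ≡ u ⊎ x ≡ v
    member x∈ = Sum.map (x∈⁅y⁆⇒x≡y u) (x∈⁅y⁆⇒x≡y v) (x∈p∪q⁻ ⁅ u ⁆ ⁅ v ⁆ x∈)

    u∈ : u ∈ ⁅ u ⁆ ∪ ⁅ v ⁆
    u∈ = x∈p∪q⁺ (inj₁ (x∈⁅x⁆ u))

    v∈ : v ∈ ⁅ u ⁆ ∪ ⁅ v ⁆
    v∈ = x∈p∪q⁺ (inj₂ (x∈⁅x⁆ v))

    parent : ∀ {a b} → b ≢ a → b ≡ a ⊎ T (E b a) → T (E b a)
    parent b≢a = Sum.[ (λ b≡a → contradiction b≡a b≢a) , id ]

    sink⇒edge : ∃ (IsSinkOf (⁅ u ⁆ ∪ ⁅ v ⁆)) → T (E v u ∨ E u v)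
    sink⇒edge (a , a∈ , parents) with member a∈
    ... | inj₁ refl = from T-∨ (inj₁ (parent (u≢v ∘ sym) (parents v∈)))
    ... | inj₂ refl = from T-∨ (inj₂ (parent u≢v (parents u∈)))

    edge⇒sink : T (E v u ∨ E u v) → ∃ (IsSinkOf (⁅ u ⁆ ∪ ⁅ v ⁆))
    edge⇒sink t with to T-∨ t
    ... | inj₁ vu = u , u∈ , λ b∈ → Sum.map₂ (λ { refl → vu }) (member b∈)
    ... | inj₂ uv = v , v∈ , λ b∈ → Sum.swap (Sum.map₁ (λ { refl → uv }) (member b∈))

  charImset-cong : ∀ {E′ : Digraph n} → (∀ b a → E b a ≡ E′ b a) →
                   ∀ A → charImset E A ≡ charImset E′ A
  charImset-cong E≗E′ A =
    cong or (map-cong (λ a → cong (lookup A a ∧_) (cong and (map-cong (λ b →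
      cong (λ e → not (lookup A b) ∨ ⌊ b Fin.≟ a ⌋ ∨ e) (E≗E′ b a)) (allFin n)))) (allFin n))

↑ˡ≢↑ʳ : ∀ {m n} (i : Fin m) (k : Fin n) → i ↑ˡ n ≢ m ↑ʳ k
↑ˡ≢↑ʳ {m} {n} i k eq
  with trans (sym (splitAt-↑ˡ m i n)) (trans (cong (splitAt m) eq) (splitAt-↑ʳ m n k))
... | ()

module _ {p K : ℕ} (G : DAG p) where

  JDAG-target : ∀ J k i → JDAG p K G J (p ↑ʳ k) (i ↑ˡ K) ≡ lookup (J k) i
  JDAG-target J k i rewrite splitAt-↑ˡ p i K | splitAt-↑ʳ p K k = refl

  JDAG-into-intervention : ∀ J k i → JDAG p K G J (i ↑ˡ K) (p ↑ʳ k) ≡ false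
  JDAG-into-intervention J k i rewrite splitAt-↑ˡ p i K | splitAt-↑ʳ p K k = refl

  JDAG-cong : ∀ {J J′} → (∀ k i → lookup (J k) i ≡ lookup (J′ k) i) →
              ∀ u v → JDAG p K G J u v ≡ JDAG p K G J′ u v
  JDAG-cong J≗J′ u v with splitAt p u | splitAt p v
  ... | inj₁ _ | inj₁ _ = refl
  ... | inj₁ _ | inj₂ _ = refl
  ... | inj₂ k | inj₁ i = J≗J′ k i
  ... | inj₂ _ | inj₂ _ = refl

  imset-JDAG-cong : ∀ {J J′} → (∀ k i → lookup (J k) i ≡ lookup (J′ k) i) →
                    ∀ A → imsetOf (JDAG p K G J) A ≡ imsetOf (JDAG p K G J′) A
  imset-JDAG-cong J≗J′ A = cong toℚ (charImset-cong (JDAG p K G _) (JDAG-cong J≗J′) A)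

targetPair : ∀ {p K} → Fin K → Fin p → Subset (p ℕ.+ K)
targetPair {p} {K} k i = ⁅ i ↑ˡ K ⁆ ∪ ⁅ p ↑ʳ k ⁆

imset-targetPair : ∀ {p K} (G : DAG p) J k i →
                   imsetOf (JDAG p K G J) (targetPair k i) ≡ toℚ (lookup (J k) i)
imset-targetPair {p} {K} G J k i = cong toℚ (begin
  charImset (JDAG p K G J) (targetPair k i)
    ≡⟨ charImset-pair (JDAG p K G J) (↑ˡ≢↑ʳ i k) ⟩
  JDAG p K G J (p ↑ʳ k) (i ↑ˡ K) ∨ JDAG p K G J (i ↑ˡ K) (p ↑ʳ k)
    ≡⟨ cong₂ _∨_ (JDAG-target G J k i) (JDAG-into-intervention G J k i) ⟩
  lookup (J k) i ∨ false
    ≡⟨ ∨-identityʳ _ ⟩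
  lookup (J k) i ∎)
  where open ≡-Reasoning

sign : Bool → ℚ
sign true  = 1ℚ
sign false = - 1ℚ

sign*toℚ-≤ : ∀ s j → sign s * toℚ j ≤ℚ sign s * toℚ s
sign*toℚ-≤ true  true  = ≤-refl
sign*toℚ-≤ true  false = toWitness {a? = 0ℚ ≤? 1ℚ} _
sign*toℚ-≤ false true  = toWitness {a? = - 1ℚ ≤? 0ℚ} _
sign*toℚ-≤ false false = ≤-refl

sign*toℚ-≡⇒≡ : ∀ s j → sign s * toℚ j ≡ sign s * toℚ s → j ≡ s
sign*toℚ-≡⇒≡ true  true  _ = refl
sign*toℚ-≡⇒≡ false false _ = refl

agreement : ∀ {p K} → (Fin K → Subset p) → (Fin K → Subset p) → ℚ
agreement {p} {K} I J = sumFin K λ k → sumFin p λ i → sign (lookup (I k) i) * toℚ (lookup (J k) i)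

agreement-≤ : ∀ {p K} (I J : Fin K → Subset p) → agreement I J ≤ℚ agreement I I
agreement-≤ {p} {K} I J =
  sumFin-mono-≤ K λ k → sumFin-mono-≤ p λ i → sign*toℚ-≤ (lookup (I k) i) (lookup (J k) i)

agreement-≡⇒≗ : ∀ {p K} (I J : Fin K → Subset p) → agreement I J ≡ agreement I I →
                ∀ k i → lookup (J k) i ≡ lookup (I k) i
agreement-≡⇒≗ {p} {K} I J eq k i =
  sign*toℚ-≡⇒≡ (lookup (I k) i) (lookup (J k) i)
    (sumFin-mono-≤-tight p (term-≤ k) (sumFin-mono-≤-tight K (sumFin-mono-≤ p ∘ term-≤) eq k) i)
  where
  term-≤ : ∀ k i → sign (lookup (I k) i) * toℚ (lookup (J k) i) ≤ℚ
                   sign (lookup (I k) i) * toℚ (lookup (I k) i)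
  term-≤ k i = sign*toℚ-≤ (lookup (I k) i) (lookup (J k) i)

targetWeight : ∀ {p K} → (Fin K → Subset p) → Point (p ℕ.+ K)
targetWeight {p} {K} I A = sumFin K λ k → sumFin p λ i → sign (lookup (I k) i) * basis (targetPair k i) A

dot-targetWeight : ∀ {p K} (I : Fin K → Subset p) (x : Point (p ℕ.+ K)) →
                   dot (targetWeight I) x ≡
                   sumFin K λ k → sumFin p λ i → sign (lookup (I k) i) * x (targetPair k i)
dot-targetWeight {p} {K} I x = begin
  dot (targetWeight I) x
    ≡⟨ dot-sumFinˡ K _ x ⟩
  sumFin K (λ k → dot (λ A → sumFin p λ i → sign (lookup (I k) i) * basis (targetPair k i) A) x)
    ≡⟨ sumFin-cong K (λ k → dot-sumFinˡ p _ x) ⟩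
  sumFin K (λ k → sumFin p λ i → dot (λ A → sign (lookup (I k) i) * basis (targetPair k i) A) x)
    ≡⟨ sumFin-cong K (λ k → sumFin-cong p λ i →
         trans (dot-*ˡ (sign (lookup (I k) i)) (basis (targetPair k i)) x)
               (cong (sign (lookup (I k) i) *_) (dot-basisˡ (targetPair k i) x))) ⟩
  sumFin K (λ k → sumFin p λ i → sign (lookup (I k) i) * x (targetPair k i))
    ∎
  where open ≡-Reasoning

dot-targetWeight-imset : ∀ {p K} (I : Fin K → Subset p) (G : DAG p) J →
                         dot (targetWeight I) (imsetOf (JDAG p K G J)) ≡ agreement I J
dot-targetWeight-imset {p} {K} I G J = trans (dot-targetWeight I _)
  (sumFin-cong K λ k → sumFin-cong p λ i → cong (sign (lookup (I k) i) *_) (imset-targetPair G J k i))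

emptyDAG : ∀ {p} → DAG p
emptyDAG = record { edges = λ _ _ → false ; acyclic = λ _ → λ { (edge ()) ; (step () _) } }

IsCIMVertex : (p K : ℕ) → Point (p ℕ.+ K) → Set
IsCIMVertex p K y =
  ∃ λ (G : DAG p) → ∃ λ (J : Fin K → Subset p) → ∀ A → y A ≡ imsetOf (JDAG p K G J) A

IsCIMIVertex : (p K : ℕ) → (Fin K → Subset p) → Point (p ℕ.+ K) → Set
IsCIMIVertex p K I y = ∃ λ (G : DAG p) → ∀ A → y A ≡ imsetOf (JDAG p K G I) A

proposition3p8 : (p K : ℕ) → 1 ≤ p → (I : Fin K → Subset p) →
                 IsFace (CIMI p K I) (CIM p K)
proposition3p8 p K _ I =
  InConv-face (targetWeight I) (agreement I I) valid tight
    (imsetOf (JDAG p K emptyDAG I) , emptyDAG , λ _ → refl)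
  where
  score : ∀ {y} G J → (∀ A → y A ≡ imsetOf (JDAG p K G J) A) → dot (targetWeight I) y ≡ agreement I J
  score G J y≡ = trans (dot-congʳ (targetWeight I) y≡) (dot-targetWeight-imset I G J)

  valid : ∀ y → IsCIMVertex p K y → dot (targetWeight I) y ≤ℚ agreement I I
  valid y (G , J , y≡) = ≤-trans (≤-reflexive (score G J y≡)) (agreement-≤ I J)

  tight : ∀ y → IsCIMIVertex p K I y ⇔ (IsCIMVertex p K y × dot (targetWeight I) y ≡ agreement I I)
  tight y = mk⇔ (λ (G , y≡) → (G , I , y≡) , score G I y≡) λ ((G , J , y≡) , wy≡b) →
    G , λ A → trans (y≡ A) (imset-JDAG-cong G (agreement-≡⇒≗ I J (trans (sym (score G J y≡)) wy≡b)) A)
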